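{- Let $\Gamma \vdash^{w} M : \mathtt{a}$ be derivable in the type system described in the context, where $\mathtt{a}$ is a type distribution. Then $\mathrm{dom}(\Gamma)\subseteq \mathrm{fv}(M)$, and if $M$ is closed then $\Gamma$ is empty.
   Context: Terms (call-by-value probabilistic $\lambda$-calculus): values $V ::= x \mid \lambda x.M$; terms $M ::= V \mid VV \mid M\oplus M \mid \mathtt{let}\ x = M\ \mathtt{in}\ M$ (where $x$ is bound in the second term). $\mathrm{fv}(M)$ is the set of free variables; $M\{V/x\}$ is capture-avoiding substitution. Types: arrow types $\mathtt{A} ::= \mathcal{M}\to \mathtt{a}$; intersection types $\mathcal{M} ::= [q_1\cdot \mathtt{A}_1,\dots,q_n\cdot\mathtt{A}_n]$ ($n\ge 0$), a finite multiset of pairs with scale factors $q_i\in(0,1]\cap\mathbb{Q}$; type distributions $\mathtt{a} ::= \langle p_1\mathcal{M}_1,\dots,p_n\mathcal{M}_n\rangle$ ($n\ge0$), a finite multiset of pairs with $p_i\in(0,1]$ and $\sum_i p_i\le 1$ (a multidistribution). $\mathbf{0}$ is the empty type distribution; $\|\mathtt{a}\|=\sum_i p_i$. For a scalar $u$, $u\cdot[q_i\cdot\mathtt{A}_i]_i=[(uq_i)\cdot \mathtt{A}_i]_i$ and $u\cdot\langle p_i\mathcal{M}_i\rangle_i=\langle (up_i)\mathcal{M}_i\rangle_i$; $\uplus$ and $\sqcup$ denote multiset union of intersection types and of type distributions. A typing context $\Gamma$ maps variables to intersection types, with $\mathrm{dom}(\Gamma)=\{x\mid \Gamma(x)\neq[\,]\}$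 finite; $\Gamma\uplus\Delta$ and $q\cdot\Gamma$ are pointwise; $\Gamma,x:\mathcal{M}$ requires $x\notin\mathrm{dom}(\Gamma)$. Judgements $\Gamma\vdash^{w} M:\tau$ with weight $w\in\mathbb{Q}$ and $\tau$ an arrow type, intersection type or type distribution, derived by the rules: (Var) $x:\mathcal{M}\vdash^0 x:\mathcal{M}$. (Zero) $\vdash^0 M:\mathbf{0}$ for any term $M$ (empty context). (@) from $\Gamma\vdash^{w}V:[1\cdot(\mathcal{M}\to\mathtt{b})]$ and $\Delta\vdash^{v}W:\mathcal{M}$ infer $\Gamma\uplus\Delta\vdash^{w+v}VW:\mathtt{b}$. ($\oplus$) from $\Gamma\vdash^{w}M:\mathtt{a}$ and $\Delta\vdash^{v}N:\mathtt{b}$ infer $\tfrac12\cdot\Gamma\uplus\tfrac12\cdot\Delta\vdash^{\frac12 w+\frac12 v+1}M\oplus N:\tfrac12\mathtt{a}\sqcup\tfrac12\mathtt{b}$. ($\lambda$) from $\Gamma,x:\mathcal{M}\vdash^{w}M:\mathtt{b}$ infer $\Gamma\vdash^{w+1}\lambda x.M:\mathcal{M}\to\mathtt{b}$. (let) from $\Gamma\vdash^{v}N:\langle p_k\mathcal{M}_k\rangle_{k\in K}$ and, for each $k\in K$, $\Delta_k,x:\mathcal{M}_k\vdash^{w_k}M:\mathtt{b}_k$, infer $\Gamma\uplus_{k}p_k\cdot\Delta_k\vdash^{\sum_k p_kw_k+v+1}\mathtt{let}\ x=N\ \mathtt{in}\ M:\bigsqcup_k p_k\mathtt{b}_k$.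 (Val) from $\Gamma\vdash^{w}V:\mathcal{M}$ ($V$ a value) infer $\Gamma\vdash^{w}V:\langle 1\mathcal{M}\rangle$. (!) for a finite, possibly empty, index set $I$, from $\Gamma_i\vdash^{w_i}V:\mathtt{A}_i$ ($V$ a value) and scale factors $q_i$ ($i\in I$) infer $\uplus_i q_i\cdot\Gamma_i\vdash^{\sum_i q_iw_i}V:[q_i\cdot\mathtt{A}_i]_{i\in I}$. -}

module Defs where

open import Data.Nat using (ℕ) renaming (_≟_ to _≟ℕ_)
open import Data.Rational using (ℚ; 0ℚ; 1ℚ; ½; _+_; _*_; _≤_; _<_)
open import Data.List using (List; []; _∷_; _++_; map; foldr)
open import Data.Product using (_×_; _,_; proj₁; map₁)
open import Data.Bool using (if_then_else_)
open import Relation.Nullary using (¬_; does)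
open import Relation.Binary.PropositionalEquality using (_≡_; _≢_)

Var : Set
Var = ℕ

data Val : Set
data Term : Set

data Val where
  var : Var → Val
  lam : Var → Term → Val

data Term where
  val  : Val → Term
  app  : Val → Val → Term
  _⊕_  : Term → Term → Term
  lett : Var → Term → Term → Term  -- lett x N M  =  let x = N in M

data _∈fvV_ : Var → Val → Set
data _∈fv_  : Var → Term → Set

data _∈fvV_ where
  fv-var : ∀ {x} → x ∈fvV var x
  fv-lam : ∀ {x y M} → x ≢ y → x ∈fv M → x ∈fvV lam y M

data _∈fv_ where
  fv-val  : ∀ {x V} → x ∈fvV V → x ∈fv val V
  fv-appˡ : ∀ {x V W} → x ∈fvV V → x ∈fv app V W
  fv-appʳ : ∀ {x V W} → x ∈fvV W → x ∈fv app V W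
  fv-⊕ˡ   : ∀ {x M N} → x ∈fv M → x ∈fv (M ⊕ N)
  fv-⊕ʳ   : ∀ {x M N} → x ∈fv N → x ∈fv (M ⊕ N)
  fv-letˡ : ∀ {x y N M} → x ∈fv N → x ∈fv lett y N M
  fv-letʳ : ∀ {x y N M} → x ≢ y → x ∈fv M → x ∈fv lett y N M

Closed : Term → Set
Closed M = ∀ x → ¬ (x ∈fv M)

-- Types. Multisets are represented by lists, considered up to the
-- (deep) permutation equivalence defined below.

data Arrow : Set where
  _⇒_ : List (ℚ × Arrow) → List (ℚ × List (ℚ × Arrow)) → Arrow

Inter : Set
Inter = List (ℚ × Arrow)

Dist : Set
Dist = List (ℚ × Inter)

𝟎 : Dist
𝟎 = []

‖_‖ : Dist → ℚ
‖ a ‖ = foldr (λ pM r → proj₁ pM + r) 0ℚ a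

scaleI : ℚ → Inter → Inter
scaleI u = map (map₁ (u *_))

scaleD : ℚ → Dist → Dist
scaleD u = map (map₁ (u *_))

InUnit : ℚ → Set
InUnit q = (0ℚ < q) × (q ≤ 1ℚ)

data WFA : Arrow → Set
data WFI : Inter → Set
data WFDelems : Dist → Set
data WFD : Dist → Set

data WFA where
  wf⇒ : ∀ {M a} → WFI M → WFD a → WFA (M ⇒ a)

data WFI where
  []  : WFI []
  _∷_ : ∀ {q A I} → InUnit q × WFA A → WFI I → WFI ((q , A) ∷ I)

data WFDelems where
  []  : WFDelems []
  _∷_ : ∀ {p M a} → InUnit p × WFI M → WFDelems a → WFDelems ((p , M) ∷ a)

data WFD where
  wfD : ∀ {a} → WFDelems a → ‖ a ‖ ≤ 1ℚ → WFD a

data _≈A_ : Arrow → Arrow → Set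
data _≈I_ : Inter → Inter → Set
data _≈D_ : Dist → Dist → Set

data _≈A_ where
  ⇒-cong : ∀ {M M' a a'} → M ≈I M' → a ≈D a' → (M ⇒ a) ≈A (M' ⇒ a')

data _≈I_ where
  []    : [] ≈I []
  cons  : ∀ {q A B I J} → A ≈A B → I ≈I J → ((q , A) ∷ I) ≈I ((q , B) ∷ J)
  swap  : ∀ {q r A B I} → ((q , A) ∷ (r , B) ∷ I) ≈I ((r , B) ∷ (q , A) ∷ I)
  trans : ∀ {I J K} → I ≈I J → J ≈I K → I ≈I K

data _≈D_ where
  []    : [] ≈D []
  cons  : ∀ {p M N a b} → M ≈I N → a ≈D b → ((p , M) ∷ a) ≈D ((p , N) ∷ b)
  swap  : ∀ {p r M N a} → ((p , M) ∷ (r , N) ∷ a) ≈D ((r , N) ∷ (p , M) ∷ a)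
  trans : ∀ {a b c} → a ≈D b → b ≈D c → a ≈D c

data Ty : Set where
  arr  : Arrow → Ty
  int  : Inter → Ty
  dist : Dist → Ty

data _≈T_ : Ty → Ty → Set where
  arr≈  : ∀ {A B} → A ≈A B → arr A ≈T arr B
  int≈  : ∀ {M N} → M ≈I N → int M ≈T int N
  dist≈ : ∀ {a b} → a ≈D b → dist a ≈T dist b

Ctx : Set
Ctx = Var → Inter

∅ : Ctx
∅ _ = []

_∈dom_ : Var → Ctx → Set
x ∈dom Γ = Γ x ≢ []

_⊎C_ : Ctx → Ctx → Ctx
(Γ ⊎C Δ) x = Γ x ++ Δ x

_·C_ : ℚ → Ctx → Ctx
(q ·C Γ) x = scaleI q (Γ x)

-- Γ , x ∶ M   (used only when x ∉ dom Γ)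
_,_∶_ : Ctx → Var → Inter → Ctx
(Γ , x ∶ M) y = if does (y ≟ℕ x) then M else Γ y

_≈C_ : Ctx → Ctx → Set
Γ ≈C Δ = ∀ x → Γ x ≈I Δ x

infixl 6 _⊎C_
infixl 7 _·C_
infix 4 _⊢[_]_∶_

data _⊢[_]_∶_ : Ctx → ℚ → Term → Ty → Set
-- premises of (let): one derivation for each k ∈ K, accumulating
-- ⊎ₖ pₖ·Δₖ, Σₖ pₖwₖ and ⊔ₖ pₖbₖ
data Branches (x : Var) (M : Term) : Dist → Ctx → ℚ → Dist → Set
-- premises of (!): one derivation for each i ∈ I, accumulating
-- ⊎ᵢ qᵢ·Γᵢ, Σᵢ qᵢwᵢ and [qᵢ·Aᵢ]ᵢ
data Bang (V : Val) : Ctx → ℚ → Inter → Set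

data _⊢[_]_∶_ where
  t-var  : ∀ {x M} → WFI M → (∅ , x ∶ M) ⊢[ 0ℚ ] val (var x) ∶ int M
  t-zero : ∀ {M} → ∅ ⊢[ 0ℚ ] M ∶ dist 𝟎
  t-app  : ∀ {Γ Δ w v V W M b} →
           Γ ⊢[ w ] val V ∶ int ((1ℚ , (M ⇒ b)) ∷ []) →
           Δ ⊢[ v ] val W ∶ int M →
           Γ ⊎C Δ ⊢[ w + v ] app V W ∶ dist b
  t-⊕    : ∀ {Γ Δ w v M N a b} →
           Γ ⊢[ w ] M ∶ dist a →
           Δ ⊢[ v ] N ∶ dist b →
           ½ ·C Γ ⊎C ½ ·C Δ ⊢[ ½ * w + ½ * v + 1ℚ ] (M ⊕ N) ∶ dist (scaleD ½ a ++ scaleD ½ b)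
  t-lam  : ∀ {Γ x M w N b} →
           Γ x ≡ [] →
           (Γ , x ∶ M) ⊢[ w ] N ∶ dist b →
           Γ ⊢[ w + 1ℚ ] val (lam x N) ∶ arr (M ⇒ b)
  t-let  : ∀ {Γ Θ v W x N M a B} →
           Γ ⊢[ v ] N ∶ dist a →
           Branches x M a Θ W B →
           Γ ⊎C Θ ⊢[ W + v + 1ℚ ] lett x N M ∶ dist B
  t-val  : ∀ {Γ w V M} →
           Γ ⊢[ w ] val V ∶ int M →
           Γ ⊢[ w ] val V ∶ dist ((1ℚ , M) ∷ [])
  t-!    : ∀ {Γ w V M} →
           Bang V Γ w M →
           Γ ⊢[ w ] val V ∶ int M
  -- multisets are lists up to ≈ : judgements are closed under ≈
  t-conv : ∀ {Γ Γ' w M τ τ'} →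
           Γ ⊢[ w ] M ∶ τ → Γ ≈C Γ' → τ ≈T τ' →
           Γ' ⊢[ w ] M ∶ τ'

data Branches x M where
  []  : Branches x M [] ∅ 0ℚ []
  _∷_ : ∀ {p Mk Δ w b a Θ W B} →
        (Δ x ≡ []) × ((Δ , x ∶ Mk) ⊢[ w ] M ∶ dist b) →
        Branches x M a Θ W B →
        Branches x M ((p , Mk) ∷ a) (p ·C Δ ⊎C Θ) (p * w + W) (scaleD p b ++ B)

data Bang V where
  []  : Bang V ∅ 0ℚ []
  _∷_ : ∀ {q Γ w A Θ W I} →
        InUnit q × (Γ ⊢[ w ] val V ∶ arr A) →
        Bang V Θ W I →
        Bang V (q ·C Γ ⊎C Θ) (q * w + W) ((q , A) ∷ I)

-- Induction on derivations, for every sort of type at once: each rule forms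
-- its context from those of its premises by ⊎, scaling and removing the bound
-- variable, and its subject contains the premises' subjects outside that
-- binder; the only leaves are (Var), whose context is the typed variable, and
-- empty contexts.  A closed term then has nothing in its domain.
module Submission where

open import Defs
open import Data.Rational using (ℚ; ½)
open import Data.Nat using (_≡ᵇ_)
open import Data.Nat.Properties using (≡ᵇ⇒≡)
open import Data.Bool using (true; false)
open import Data.List using (List; []; _∷_; _++_; map)
open import Data.Product using (_×_; _,_)
open import Data.Sum using (_⊎_; inj₁; inj₂)
open import Data.Empty using (⊥-elim)
open import Function using (_∘_)
open import Relation.Nullary using (¬_)
open import Relation.Binary.PropositionalEquality using (_≡_; refl; _≢_; sym; subst)

module _ {A : Set} where

  ++-≢[] : (xs ys : List A) → xs ++ ys ≢ [] → xs ≢ [] ⊎ ys ≢ []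
  ++-≢[] []      ys ne = inj₂ ne
  ++-≢[] (_ ∷ _) ys _  = inj₁ λ ()

  map-≢[] : ∀ {B : Set} (f : A → B) (xs : List A) → map f xs ≢ [] → xs ≢ []
  map-≢[] f []      ne = ⊥-elim (ne refl)
  map-≢[] f (_ ∷ _) _  = λ ()

  ≡[]-stable : (xs : List A) → ¬ xs ≢ [] → xs ≡ []
  ≡[]-stable []      _   = refl
  ≡[]-stable (_ ∷ _) ¬ne = ⊥-elim (¬ne λ ())

≈I-[] : ∀ {I J} → I ≈I J → I ≡ [] → J ≡ []
≈I-[] []          refl = refl
≈I-[] (trans p q) I≡[] = ≈I-[] q (≈I-[] p I≡[])

-- `does (y ≟ x)` evaluates to the builtin `y ≡ᵇ x`, so lookups split on that.
,∶-lookup-≢ : ∀ Γ x M {y} → y ≢ x → (Γ , x ∶ M) y ≡ Γ y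
,∶-lookup-≢ Γ x M {y} y≢x with y ≡ᵇ x | ≡ᵇ⇒≡ y x
... | true  | y≡x = ⊥-elim (y≢x (y≡x _))
... | false | _   = refl

∈dom-∅-singleton : ∀ x M y → y ∈dom (∅ , x ∶ M) → y ≡ x
∈dom-∅-singleton x M y y∈ with y ≡ᵇ x | ≡ᵇ⇒≡ y x
... | true  | y≡x = y≡x _
... | false | _   = ⊥-elim (y∈ refl)

∈dom-⊎C : ∀ Γ Δ y → y ∈dom (Γ ⊎C Δ) → y ∈dom Γ ⊎ y ∈dom Δ
∈dom-⊎C Γ Δ y = ++-≢[] (Γ y) (Δ y)

∈dom-·C : ∀ q Γ y → y ∈dom (q ·C Γ) → y ∈dom Γ
∈dom-·C q Γ y = map-≢[] _ (Γ y)

∈dom-≈C : ∀ {Γ Δ} → Γ ≈C Δ → ∀ y → y ∈dom Δ → y ∈dom Γ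
∈dom-≈C Γ≈Δ y y∈Δ = y∈Δ ∘ ≈I-[] (Γ≈Δ y)

∈dom-, : ∀ Γ x M y → Γ x ≡ [] → y ∈dom Γ → y ≢ x × y ∈dom (Γ , x ∶ M)
∈dom-, Γ x M y Γx≡[] y∈Γ = y≢x , subst (_≢ []) (sym (,∶-lookup-≢ Γ x M y≢x)) y∈Γ
  where
  y≢x : y ≢ x
  y≢x refl = y∈Γ Γx≡[]

⊢-dom⊆fv        : ∀ {Γ w M τ} → Γ ⊢[ w ] M ∶ τ → ∀ y → y ∈dom Γ → y ∈fv M
Branches-dom⊆fv : ∀ {x M a Θ W B} → Branches x M a Θ W B →
                  ∀ y → y ∈dom Θ → y ≢ x × y ∈fv M
Bang-dom⊆fv     : ∀ {V Θ W I} → Bang V Θ W I → ∀ y → y ∈dom Θ → y ∈fv val V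

⊢-dom⊆fv (t-var {x} {M} _) y y∈ with refl ← ∈dom-∅-singleton x M y y∈ = fv-val fv-var
⊢-dom⊆fv t-zero y y∈ = ⊥-elim (y∈ refl)
⊢-dom⊆fv (t-app {Γ} {Δ} ⊢V ⊢W) y y∈ with ∈dom-⊎C Γ Δ y y∈
... | inj₁ y∈Γ with fv-val y∈V ← ⊢-dom⊆fv ⊢V y y∈Γ = fv-appˡ y∈V
... | inj₂ y∈Δ with fv-val y∈W ← ⊢-dom⊆fv ⊢W y y∈Δ = fv-appʳ y∈W
⊢-dom⊆fv (t-⊕ {Γ} {Δ} ⊢M ⊢N) y y∈ with ∈dom-⊎C (½ ·C Γ) (½ ·C Δ) y y∈
... | inj₁ y∈Γ = fv-⊕ˡ (⊢-dom⊆fv ⊢M y (∈dom-·C ½ Γ y y∈Γ))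
... | inj₂ y∈Δ = fv-⊕ʳ (⊢-dom⊆fv ⊢N y (∈dom-·C ½ Δ y y∈Δ))
⊢-dom⊆fv (t-lam {Γ} {x} {M} Γx≡[] ⊢N) y y∈ =
  let y≢x , y∈Γ,x = ∈dom-, Γ x M y Γx≡[] y∈
  in  fv-val (fv-lam y≢x (⊢-dom⊆fv ⊢N y y∈Γ,x))
⊢-dom⊆fv (t-let {Γ} {Θ} ⊢N branches) y y∈ with ∈dom-⊎C Γ Θ y y∈
... | inj₁ y∈Γ = fv-letˡ (⊢-dom⊆fv ⊢N y y∈Γ)
... | inj₂ y∈Θ = let y≢x , y∈M = Branches-dom⊆fv branches y y∈Θ in fv-letʳ y≢x y∈M
⊢-dom⊆fv (t-val ⊢V) y y∈ = ⊢-dom⊆fv ⊢V y y∈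
⊢-dom⊆fv (t-! bang) y y∈ = Bang-dom⊆fv bang y y∈
⊢-dom⊆fv (t-conv ⊢M Γ≈Γ' _) y y∈ = ⊢-dom⊆fv ⊢M y (∈dom-≈C Γ≈Γ' y y∈)

Branches-dom⊆fv [] y y∈ = ⊥-elim (y∈ refl)
Branches-dom⊆fv {x} (_∷_ {p} {Mk} {Δ} {Θ = Θ} (Δx≡[] , ⊢M) branches) y y∈
  with ∈dom-⊎C (p ·C Δ) Θ y y∈
... | inj₁ y∈pΔ = let y≢x , y∈Δ,x = ∈dom-, Δ x Mk y Δx≡[] (∈dom-·C p Δ y y∈pΔ)
                  in  y≢x , ⊢-dom⊆fv ⊢M y y∈Δ,x
... | inj₂ y∈Θ  = Branches-dom⊆fv branches y y∈Θ

Bang-dom⊆fv [] y y∈ = ⊥-elim (y∈ refl)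
Bang-dom⊆fv (_∷_ {q} {Γ} {Θ = Θ} (_ , ⊢V) bang) y y∈ with ∈dom-⊎C (q ·C Γ) Θ y y∈
... | inj₁ y∈qΓ = ⊢-dom⊆fv ⊢V y (∈dom-·C q Γ y y∈qΓ)
... | inj₂ y∈Θ  = Bang-dom⊆fv bang y y∈Θ

mainTheorem1 : ∀ {Γ : Ctx} {w : ℚ} {M : Term} {a : Dist} →
               Γ ⊢[ w ] M ∶ dist a →
               (∀ x → x ∈dom Γ → x ∈fv M) × (Closed M → ∀ x → Γ x ≡ [])
mainTheorem1 {Γ} {M = M} ⊢M = dom⊆fv , λ closed x → ≡[]-stable (Γ x) (closed x ∘ dom⊆fv x)
  where
  dom⊆fv : ∀ x → x ∈dom Γ → x ∈fv M
  dom⊆fv = ⊢-dom⊆fv ⊢M
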